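{- Let $m\ge2$, $k\ge1$, $g\ge0$, $n=m+g(m-1)$, and let $D,D'$ be $(m-1)$-Dyck paths of length $n-1$. If $D$ and $D'$ are $k$-equivalent, then $d(D)\equiv d(D')\pmod{k(m-1)}$ componentwise.
   Context: $N$ denotes the unit step $(1,1)$, $S$ the step $(1,-1)$; lattice paths are identified with words in $N,S$. An $(m-1)$-Dyck path is a lattice path from $(0,0)$ with up-steps $(m-1,m-1)$ and down-steps $(1,-1)$, never below the $x$-axis and ending on it; its length is its number of down-steps. Each $(m-1)$-Dyck path $D$ of length $n-1$ is uniquely written $N^{d_1}SN^{d_2}S\dots SN^{d_{n-1}}SN^{d_n}$ with $d_i$ non-negative multiples of $m-1$ and $d_n=0$; $d(D):=(d_1,\dots,d_n)$. Right $k$-compression: replace a consecutive subword $X=N^{m-1}D_1SD_2S\dots D_{j-1}SN^{k(m-1)}D_jSD_{j+1}S\dots SD_{m+k(m-1)}$ ($1\le j\le m-1$, each $D_i$ a possibly empty word that is an $(m-1)$-Dyck path up to translation) by $X'=N^{m-1}D_1S\dots D_{j-1}SD_jSN^{k(m-1)}D_{j+1}S\dots SD_{m+k(m-1)}$; left $k$-compression is the inverse. Two paths are $k$-equivalent if one is obtained from the other by a finite sequence of right and left $k$-compressions. -}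

module Defs where

open import Data.Nat using (ℕ; zero; suc; _+_; _*_; _∸_; _≤_)
open import Data.List using (List; []; _∷_; _++_; replicate; length)
open import Data.List.Relation.Unary.All using (All)
open import Data.List.Relation.Binary.Pointwise using (Pointwise)
open import Data.Product using (Σ; _×_; ∃; ∃-syntax)
open import Relation.Binary.PropositionalEquality using (_≡_)
open import Relation.Binary.Construct.Closure.Equivalence using (EqClosure)

-- Unit steps: N = (1,1), S = (1,-1).  Lattice paths are words in N, S.
data Step : Set where
  N S : Step

Word : Set
Word = List Step

data DyckFrom : ℕ → Word → Set where
  done : DyckFrom zero []
  up   : ∀ {h w} → DyckFrom (suc h) w → DyckFrom h (N ∷ w)
  down : ∀ {h w} → DyckFrom h w → DyckFrom (suc h) (S ∷ w)

data BigSteps (m : ℕ) : Word → Set where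
  []ᵇ  : BigSteps m []
  upᵇ  : ∀ {w} → BigSteps m w → BigSteps m (replicate (m ∸ 1) N ++ w)
  downᵇ : ∀ {w} → BigSteps m w → BigSteps m (S ∷ w)

-- (m-1)-Dyck path (as a word in N,S): made of up-steps (m-1,m-1) and down-steps
-- (1,-1), never below the x-axis, starting and ending on it.
IsDyck : ℕ → Word → Set
IsDyck m w = BigSteps m w × DyckFrom zero w

-- number of S steps (= number of down-steps = length of the Dyck path)
countS : Word → ℕ
countS [] = zero
countS (N ∷ w) = countS w
countS (S ∷ w) = suc (countS w)

-- d(D): the lengths of the maximal N-runs separated by the S's:
-- D = N^{d_1} S N^{d_2} S ... S N^{d_n}.
dvec : Word → List ℕ
dvec [] = zero ∷ []
dvec (N ∷ w) with dvec w
... | [] = 1 ∷ []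
... | x ∷ xs = suc x ∷ xs
dvec (S ∷ w) = zero ∷ dvec w

joinS : List Word → Word
joinS [] = []
joinS (D ∷ []) = D
joinS (D ∷ E ∷ Ds) = D ++ (S ∷ joinS (E ∷ Ds))

-- prepend the word u to the i-th (0-based) entry of a list
prependAt : ℕ → Word → List Word → List Word
prependAt i u [] = []
prependAt zero u (D ∷ Ds) = (u ++ D) ∷ Ds
prependAt (suc i) u (D ∷ Ds) = D ∷ prependAt i u Ds

-- Right k-compression (for parameter m): w = p ++ X ++ q, w' = p ++ X' ++ q with
-- X  = N^{m-1} D_1 S ... D_{j-1} S N^{k(m-1)} D_j S D_{j+1} S ... S D_{m+k(m-1)}
-- X' = N^{m-1} D_1 S ... D_{j-1} S D_j S N^{k(m-1)} D_{j+1} S ... S D_{m+k(m-1)}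
-- with 1 ≤ j ≤ m-1 and each D_i an (m-1)-Dyck path up to translation.
record RightComp (m k : ℕ) (w w' : Word) : Set where
  field
    p q : Word
    j   : ℕ
    j≥1 : 1 ≤ j
    j≤  : j ≤ m ∸ 1
    Ds  : List Word
    len : length Ds ≡ m + k * (m ∸ 1)
    dyck : All (IsDyck m) Ds
    eqw  : w ≡ p ++ (replicate (m ∸ 1) N ++ joinS (prependAt (j ∸ 1) (replicate (k * (m ∸ 1)) N) Ds)) ++ q
    eqw' : w' ≡ p ++ (replicate (m ∸ 1) N ++ joinS (prependAt j (replicate (k * (m ∸ 1)) N) Ds)) ++ q

-- k-equivalence: finite sequences of right and left (= inverse) k-compressions.
KEquiv : ℕ → ℕ → Word → Word → Set
KEquiv m k = EqClosure (RightComp m k)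

ModEq : ℕ → ℕ → ℕ → Set
ModEq r a b = ∃[ x ] ∃[ y ] (a + x * r ≡ b + y * r)

-- A right k-compression only moves the run N^{k(m-1)} from the front of the block D_j to the
-- front of D_{j+1}.  Both paths therefore arise from one common path by inserting N^{k(m-1)}
-- at some position, and such an insertion adds k(m-1) to exactly one entry of d and leaves
-- the others unchanged.  Congruence modulo k(m-1) is an equivalence, so it survives chains
-- of compressions in either direction.
module Submission where

open import Defs
open import Data.Nat using (ℕ; zero; suc; _+_; _*_; _∸_; _≤_)
open import Data.Nat.Properties using (+-comm; +-identityʳ)
open import Data.Nat.Tactic.RingSolver using (solve-∀)
open import Data.List using (List; []; _∷_; _++_; replicate)
open import Data.List.Properties using (++-assoc)
open import Data.List.Relation.Binary.Pointwise as Pointwise using (Pointwise; []; _∷_)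
open import Data.Product using (_×_; _,_; ∃-syntax)
open import Function using (_∘_)
open import Relation.Binary.Structures using (IsEquivalence)
open import Relation.Binary.PropositionalEquality
open import Relation.Binary.Construct.Closure.Equivalence using (gfold)
open import Relation.Binary.Construct.Closure.Reflexive as Refl using (ReflClosure; [_]; refl)

modEq-isEquivalence : ∀ r → IsEquivalence (ModEq r)
modEq-isEquivalence r = record
  { refl  = 0 , 0 , refl
  ; sym   = λ (x , y , e) → y , x , sym e
  ; trans = λ {a} {b} {c} (x , y , e) (x′ , y′ , e′) → x + x′ , y′ + y , (begin
      a + (x + x′) * r    ≡⟨ distrib a x x′ r ⟩
      (a + x * r) + x′ * r ≡⟨ cong (_+ x′ * r) e ⟩
      (b + y * r) + x′ * r ≡⟨ swap b y x′ r ⟩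
      (b + x′ * r) + y * r ≡⟨ cong (_+ y * r) e′ ⟩
      (c + y′ * r) + y * r ≡⟨ sym (distrib c y′ y r) ⟩
      c + (y′ + y) * r    ∎)
  }
  where
  open ≡-Reasoning
  distrib : ∀ a x y r → a + (x + y) * r ≡ (a + x * r) + y * r
  distrib = solve-∀
  swap : ∀ a x y r → (a + x * r) + y * r ≡ (a + y * r) + x * r
  swap = solve-∀

r+a≡a-mod-r : ∀ r a → ModEq r (r + a) a
r+a≡a-mod-r r a = 0 , 1 , (begin
  r + a + 0 ≡⟨ +-identityʳ (r + a) ⟩
  r + a     ≡⟨ +-comm r a ⟩
  a + r     ≡⟨ cong (a +_) (sym (+-identityʳ r)) ⟩
  a + 1 * r ∎)
  where open ≡-Reasoning

PointwiseModEq : ℕ → List ℕ → List ℕ → Set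
PointwiseModEq r = Pointwise (ModEq r)

pointwiseModEq-isEquivalence : ∀ r → IsEquivalence (PointwiseModEq r)
pointwiseModEq-isEquivalence r = Pointwise.isEquivalence (modEq-isEquivalence r)

module _ {r : ℕ} where
  open IsEquivalence (pointwiseModEq-isEquivalence r) public
    renaming (refl to ≋-refl; sym to ≋-sym; trans to ≋-trans)

dvec-nonEmpty : ∀ w → ∃[ x ] ∃[ xs ] dvec w ≡ x ∷ xs
dvec-nonEmpty [] = 0 , [] , refl
dvec-nonEmpty (S ∷ w) = 0 , dvec w , refl
dvec-nonEmpty (N ∷ w) with dvec w | dvec-nonEmpty w
... | _ | x , xs , refl = suc x , xs , refl

dvec-N∷ : ∀ w {x xs} → dvec w ≡ x ∷ xs → dvec (N ∷ w) ≡ suc x ∷ xs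
dvec-N∷ w eq with dvec w
dvec-N∷ w refl | _ = refl

dvec-replicateN++ : ∀ c {w x xs} → dvec w ≡ x ∷ xs → dvec (replicate c N ++ w) ≡ c + x ∷ xs
dvec-replicateN++ zero    eq = eq
dvec-replicateN++ (suc c) {w} eq = dvec-N∷ (replicate c N ++ w) (dvec-replicateN++ c eq)

dvec-N∷-cong : ∀ {r} v v′ → PointwiseModEq r (dvec v) (dvec v′) →
               PointwiseModEq r (dvec (N ∷ v)) (dvec (N ∷ v′))
dvec-N∷-cong v v′ p with dvec v | dvec v′
dvec-N∷-cong v v′ [] | [] | [] = ≋-refl
dvec-N∷-cong v v′ ((x , y , e) ∷ ps) | _ ∷ _ | _ ∷ _ = (x , y , cong suc e) ∷ ps

dvec-insertRun : ∀ c A B → PointwiseModEq c (dvec (A ++ replicate c N ++ B)) (dvec (A ++ B))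
dvec-insertRun c [] B with dvec-nonEmpty B
... | x , xs , eq =
  subst₂ (PointwiseModEq c) (sym (dvec-replicateN++ c eq)) (sym eq) (r+a≡a-mod-r c x ∷ ≋-refl)
dvec-insertRun c (N ∷ A) B = dvec-N∷-cong (A ++ replicate c N ++ B) (A ++ B) (dvec-insertRun c A B)
dvec-insertRun c (S ∷ A) B = (0 , 0 , refl) ∷ dvec-insertRun c A B

Insertion : Word → Word → Word → Set
Insertion u w w′ = ∃[ A ] ∃[ B ] (w ≡ A ++ u ++ B × w′ ≡ A ++ B)

insertion-++ˡ : ∀ {u w w′} p → Insertion u w w′ → Insertion u (p ++ w) (p ++ w′)
insertion-++ˡ {u} p (A , B , refl , refl) =
  p ++ A , B , sym (++-assoc p A (u ++ B)) , sym (++-assoc p A B)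

insertion-++ʳ : ∀ {u w w′} q → Insertion u w w′ → Insertion u (w ++ q) (w′ ++ q)
insertion-++ʳ {u} q (A , B , refl , refl) = A , B ++ q ,
  trans (++-assoc A (u ++ B) q) (cong (A ++_) (++-assoc u B q)) , ++-assoc A B q

dvec-insertion : ∀ {c w w′} → ReflClosure (Insertion (replicate c N)) w w′ →
                 PointwiseModEq c (dvec w) (dvec w′)
dvec-insertion {c} [ A , B , refl , refl ] = dvec-insertRun c A B
dvec-insertion refl = ≋-refl

joinS-prependAt : ∀ i u Ds → ReflClosure (Insertion u) (joinS (prependAt i u Ds)) (joinS Ds)
joinS-prependAt i             u []           = refl
joinS-prependAt zero          u (D ∷ [])     = [ [] , D , refl , refl ]
joinS-prependAt zero          u (D ∷ E ∷ Es) = [ [] , D ++ S ∷ joinS (E ∷ Es) , ++-assoc u D _ , refl ]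
joinS-prependAt (suc i)       u (D ∷ [])     = refl
joinS-prependAt (suc zero)    u (D ∷ E ∷ Es) =
  Refl.map (insertion-++ˡ D ∘ insertion-++ˡ (S ∷ [])) (joinS-prependAt zero u (E ∷ Es))
joinS-prependAt (suc (suc i)) u (D ∷ E ∷ Es) =
  Refl.map (insertion-++ˡ D ∘ insertion-++ˡ (S ∷ [])) (joinS-prependAt (suc i) u (E ∷ Es))

dvec-rightComp : ∀ {m k w w′} → RightComp m k w w′ →
                 PointwiseModEq (k * (m ∸ 1)) (dvec w) (dvec w′)
dvec-rightComp {m} {k} rc rewrite RightComp.eqw rc | RightComp.eqw' rc =
  ≋-trans (withoutRun (j ∸ 1)) (≋-sym (withoutRun j))
  where
  open RightComp rc
  run : Word
  run = replicate (k * (m ∸ 1)) N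
  inContext : Word → Word
  inContext v = p ++ (replicate (m ∸ 1) N ++ v) ++ q
  withoutRun : ∀ i → PointwiseModEq (k * (m ∸ 1)) (dvec (inContext (joinS (prependAt i run Ds))))
                                                   (dvec (inContext (joinS Ds)))
  withoutRun i = dvec-insertion
    (Refl.map (insertion-++ˡ p ∘ insertion-++ʳ q ∘ insertion-++ˡ (replicate (m ∸ 1) N))
              (joinS-prependAt i run Ds))

corollary3p12 : (m k g n : ℕ) → 2 ≤ m → 1 ≤ k → n ≡ m + g * (m ∸ 1) →
    (D D' : Word) → IsDyck m D → IsDyck m D' →
    countS D ≡ n ∸ 1 → countS D' ≡ n ∸ 1 →
    KEquiv m k D D' →
    Pointwise (ModEq (k * (m ∸ 1))) (dvec D) (dvec D')
corollary3p12 m k _ _ _ _ _ _ _ _ _ _ _ =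
  gfold (pointwiseModEq-isEquivalence (k * (m ∸ 1))) dvec dvec-rightComp
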